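{- Let $f \ge 0$ and $s \ge 0$ be integers, let $G$ be a directed graph, and let $r \in V(G)$. Suppose $G$ contains a set $F = \{x_1,\dots,x_f\}$ of $f$ vertices such that for each $1 \le i \le f$, the vertex $x_i$ is an $(f+2s+i-1)$-extender for $r$, and suppose $G$ contains a $(2,s)$-spider $S$ rooted at $r$ with $V(S) \cap F = \emptyset$. Then $G$ contains a $(2,f+s)$-spider rooted at $r$.
   Context: A directed graph is finite, has no loops, and may contain both edges $(x,y)$ and $(y,x)$. Write $x \to y \to z$ to mean that $(x,y)$ and $(y,z)$ are edges of $G$ and $x \ne z$. For a vertex $r$ and a vertex $x \ne r$, let $O_{x,r} = \{ y \in V(G) : (x \to y \to r) \text{ or } (y \to x \to r)\}$. For an integer $i \ge 1$, a vertex $x \ne r$ is an $i$-extender for $r$ if $|O_{x,r}| \ge i$. A $(2,s)$-spider rooted at $r$ is a subgraph consisting of $r$ together with $s$ directed paths $x_j \to y_j \to r$ ($1 \le j \le s$) on $2s+1$ pairwise distinct vertices (the $(1)$-subdivision of the in-star with $s$ leaves, with central vertex $r$); for $s=0$ it is the single vertex $r$. -}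

module Defs where

open import Data.Nat using (ℕ; _≤_)
open import Data.Fin using (Fin)
open import Data.Fin.Properties using () renaming (_≟_ to _≟ᶠ_)
open import Data.Fin.Subset using (Subset; ∣_∣)
open import Data.Bool using (Bool; true; false; _∧_; _∨_; not)
open import Data.Vec using (tabulate)
open import Data.Sum using (_⊎_; inj₁; inj₂)
open import Data.Unit using (⊤; tt)
open import Data.Product using (_×_; Σ)
open import Relation.Nullary using (¬_)
open import Relation.Nullary.Decidable using (⌊_⌋)
open import Relation.Binary.PropositionalEquality using (_≡_; _≢_)
open import Function.Definitions using (Injective)

-- A finite directed graph without loops on vertex set Fin n,
-- given by its adjacency relation (may contain both (x,y) and (y,x)).
record Digraph : Set where
  field
    n        : ℕ
    adj      : Fin n → Fin n → Bool
    loopless : ∀ x → adj x x ≡ false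

open Digraph public

Vertex : Digraph → Set
Vertex G = Fin (n G)

Edge : (G : Digraph) → Vertex G → Vertex G → Set
Edge G x y = adj G x y ≡ true

Path2 : (G : Digraph) → Vertex G → Vertex G → Vertex G → Set
Path2 G x y z = Edge G x y × Edge G y z × x ≢ z

path2? : (G : Digraph) → Vertex G → Vertex G → Vertex G → Bool
path2? G x y z = adj G x y ∧ adj G y z ∧ not ⌊ x ≟ᶠ z ⌋

O : (G : Digraph) → Vertex G → Vertex G → Subset (n G)
O G x r = tabulate λ y → path2? G x y r ∨ path2? G y x r

IsExtender : (G : Digraph) → ℕ → Vertex G → Vertex G → Set
IsExtender G i x r = x ≢ r × i ≤ ∣ O G x r ∣

-- vertex labels of a (2,s)-spider: x_j (inj₁ j), y_j (inj₂ (inj₁ j)), root r (inj₂ (inj₂ tt))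
SpiderLabel : ℕ → Set
SpiderLabel s = Fin s ⊎ (Fin s ⊎ ⊤)

spiderMap : {G : Digraph} {s : ℕ} → (Fin s → Vertex G) → (Fin s → Vertex G) → Vertex G
  → SpiderLabel s → Vertex G
spiderMap xs ys r (inj₁ j)        = xs j
spiderMap xs ys r (inj₂ (inj₁ j)) = ys j
spiderMap xs ys r (inj₂ (inj₂ _)) = r

record Spider (G : Digraph) (r : Vertex G) (s : ℕ) : Set where
  field
    xs : Fin s → Vertex G
    ys : Fin s → Vertex G
    paths : ∀ j → Path2 G (xs j) (ys j) r
    distinct : Injective _≡_ _≡_ (spiderMap {G} xs ys r)

open Spider public

vertexOf : {G : Digraph} {r : Vertex G} {s : ℕ} → Spider G r s → SpiderLabel s → Vertex G
vertexOf {G} {r} S = spiderMap {G} (xs S) (ys S) r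

InSpider : {G : Digraph} {r : Vertex G} {s : ℕ} → Spider G r s → Vertex G → Set
InSpider {s = s} S v = Σ (SpiderLabel s) λ l → vertexOf S l ≡ v

-- Since |O_{x₁,r}| ≥ f + 2s exceeds the number of leg vertices
-- of S together with x₂ … x_f, some y ∈ O_{x₁,r} avoids them all; the 2-path
-- through x₁ and y (in whichever direction it runs) forces y ≠ r and so is a new
-- leg.  For the larger spider the index required of x_{i+1} is
-- (f − 1) + 2(s + 1) + (i − 1) = f + 2s + i, so the induction hypothesis applies.
module Submission where

open import Defs
open import Data.Nat using (ℕ; zero; suc; _+_; _*_; _≤_; _<_; z≤n; s≤s)
open import Data.Nat.Properties using (≤-trans; ≤-reflexive; n≤1+n; <⇒≱; +-comm; +-suc; +-identityʳ)
open import Data.Nat.Tactic.RingSolver using (solve-∀)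
open import Data.Fin using (Fin; zero; suc; toℕ)
open import Data.Fin.Properties using (any?; suc-injective; 0≢1+n) renaming (_≟_ to _≟ᶠ_)
open import Data.Fin.Subset using (Subset; ∣_∣; _∈_; inside; outside)
open import Data.Fin.Subset.Properties using (_∈?_)
open import Data.Vec using ([]; _∷_; here; there)
open import Data.Vec.Properties using ([]=⇒lookup; lookup∘tabulate)
import Data.Vec.Functional as Vector
open import Data.List as List using (List; length; _++_)
open import Data.List.Properties using (length-++; length-tabulate)
open import Data.List.Relation.Unary.Any using (here; there)
open import Data.List.Membership.Propositional using () renaming (_∈_ to _∈ₗ_; _∉_ to _∉ₗ_)
open import Data.List.Membership.Propositional.Properties using (∈-++⁺ˡ; ∈-++⁺ʳ; ∈-tabulate⁺)
import Data.List.Membership.DecPropositional as DecMembership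
open import Data.Bool using (true; false; _∨_)
open import Data.Product using (_×_; _,_; proj₁; proj₂; Σ-syntax; ∃-syntax)
open import Data.Sum as Sum using (_⊎_; inj₁; inj₂; [_,_])
open import Data.Unit using (⊤; tt)
open import Function using (const)
open import Function.Definitions using (Injective)
open import Relation.Nullary using (¬_; yes; no; contradiction)
open import Relation.Nullary.Decidable using (_×-dec_; ¬?; decidable-stable)
open import Relation.Binary.PropositionalEquality using (_≡_; _≢_; refl; sym; trans; cong; cong₂; subst)

predecessors : ∀ {n} → List (Fin (suc n)) → List (Fin n)
predecessors List.[]          = List.[]
predecessors (zero  List.∷ L) = predecessors L
predecessors (suc y List.∷ L) = y List.∷ predecessors L

length-predecessors≤ : ∀ {n} (L : List (Fin (suc n))) → length (predecessors L) ≤ length L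
length-predecessors≤ List.[]          = z≤n
length-predecessors≤ (zero  List.∷ L) = ≤-trans (length-predecessors≤ L) (n≤1+n _)
length-predecessors≤ (suc y List.∷ L) = s≤s (length-predecessors≤ L)

length-predecessors< : ∀ {n} (L : List (Fin (suc n))) → zero ∈ₗ L → length (predecessors L) < length L
length-predecessors< (zero  List.∷ L) _         = s≤s (length-predecessors≤ L)
length-predecessors< (suc y List.∷ L) (there p) = s≤s (length-predecessors< L p)

suc∈⇒∈predecessors : ∀ {n} {y : Fin n} (L : List (Fin (suc n))) → suc y ∈ₗ L → y ∈ₗ predecessors L
suc∈⇒∈predecessors (zero  List.∷ L) (there p)   = suc∈⇒∈predecessors L p
suc∈⇒∈predecessors (suc y List.∷ L) (here refl) = here refl
suc∈⇒∈predecessors (suc y List.∷ L) (there p)   = there (suc∈⇒∈predecessors L p)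

∣p∣≤length : ∀ {n} (p : Subset n) (L : List (Fin n)) → (∀ {y} → y ∈ p → y ∈ₗ L) → ∣ p ∣ ≤ length L
∣p∣≤length []            L p⊆L = z≤n
∣p∣≤length (outside ∷ p) L p⊆L =
  ≤-trans (∣p∣≤length p (predecessors L) λ y∈p → suc∈⇒∈predecessors L (p⊆L (there y∈p)))
          (length-predecessors≤ L)
∣p∣≤length (inside ∷ p)  L p⊆L =
  ≤-trans (s≤s (∣p∣≤length p (predecessors L) λ y∈p → suc∈⇒∈predecessors L (p⊆L (there y∈p))))
          (length-predecessors< L (p⊆L here))

module _ {n : ℕ} where
  open DecMembership (_≟ᶠ_ {n}) using () renaming (_∈?_ to _∈ₗ?_)

  pigeonhole : (p : Subset n) (L : List (Fin n)) → length L < ∣ p ∣ → ∃[ y ] y ∈ p × y ∉ₗ L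
  pigeonhole p L L<p with any? (λ y → (y ∈? p) ×-dec ¬? (y ∈ₗ? L))
  ... | yes found = found
  ... | no  none  = contradiction (∣p∣≤length p L covered) (<⇒≱ L<p)
    where
    covered : ∀ {y} → y ∈ p → y ∈ₗ L
    covered {y} y∈p = decidable-stable (y ∈ₗ? L) λ y∉L → none (y , y∈p , y∉L)

[,]-injective : {A B C : Set} {g : A → C} {h : B → C}
  → Injective _≡_ _≡_ g → Injective _≡_ _≡_ h → (∀ a b → g a ≢ h b)
  → Injective _≡_ _≡_ [ g , h ]
[,]-injective g-inj h-inj g≢h {inj₁ a} {inj₁ a′} e = cong inj₁ (g-inj e)
[,]-injective g-inj h-inj g≢h {inj₁ a} {inj₂ b}  e = contradiction e (g≢h a b)
[,]-injective g-inj h-inj g≢h {inj₂ b} {inj₁ a}  e = contradiction (sym e) (g≢h a b)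
[,]-injective g-inj h-inj g≢h {inj₂ b} {inj₂ b′} e = cong inj₂ (h-inj e)

module _ (G : Digraph) where

  Edge⇒≢ : ∀ {u v} → Edge G u v → u ≢ v
  Edge⇒≢ {u} uv refl with trans (sym uv) (loopless G u)
  ... | ()

  path2?-sound : ∀ {u v w} → path2? G u v w ≡ true → Path2 G u v w
  path2?-sound {u} {v} {w} e with adj G u v | adj G v w | u ≟ᶠ w
  path2?-sound () | false | _     | _
  path2?-sound () | true  | false | _
  path2?-sound () | true  | true  | yes _
  path2?-sound _  | true  | true  | no u≢w = refl , refl , u≢w

  ∈O⇒Path2 : ∀ {x r y} → y ∈ O G x r → Path2 G x y r ⊎ Path2 G y x r
  ∈O⇒Path2 {x} {r} {y} y∈O =
    Sum.map path2?-sound path2?-sound (∨≡true (trans (sym (lookup∘tabulate _ y)) ([]=⇒lookup y∈O)))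
    where
    ∨≡true : ∀ {a b} → a ∨ b ≡ true → a ≡ true ⊎ b ≡ true
    ∨≡true {true}  _ = inj₁ refl
    ∨≡true {false} e = inj₂ e

module _ {G : Digraph} {r : Vertex G} {s : ℕ} (S : Spider G r s) where

  legs : List (Vertex G)
  legs = List.tabulate (xs S) ++ List.tabulate (ys S)

  length-legs : length legs ≡ 2 * s
  length-legs = trans (length-++ (List.tabulate (xs S)))
    (cong₂ _+_ (length-tabulate (xs S)) (trans (length-tabulate (ys S)) (sym (+-identityʳ s))))

  ∉legs⇒∉Spider : ∀ {v} → v ∉ₗ legs → v ≢ r → ¬ InSpider S v
  ∉legs⇒∉Spider v∉legs v≢r (inj₁ j        , refl) = v∉legs (∈-++⁺ˡ (∈-tabulate⁺ j))
  ∉legs⇒∉Spider v∉legs v≢r (inj₂ (inj₁ j) , refl) = v∉legs (∈-++⁺ʳ _ (∈-tabulate⁺ j))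
  ∉legs⇒∉Spider v∉legs v≢r (inj₂ (inj₂ _) , refl) = v≢r refl

module _ {G : Digraph} {r : Vertex G} {s : ℕ} (S : Spider G r s)
         {a b : Vertex G} (a→b→r : Path2 G a b r) (a∉S : ¬ InSpider S a) (b∉S : ¬ InSpider S b) where

  private
    peel : SpiderLabel (suc s) → (⊤ ⊎ ⊤) ⊎ SpiderLabel s
    peel (inj₁ zero)            = inj₁ (inj₁ tt)
    peel (inj₂ (inj₁ zero))     = inj₁ (inj₂ tt)
    peel (inj₁ (suc j))         = inj₂ (inj₁ j)
    peel (inj₂ (inj₁ (suc j)))  = inj₂ (inj₂ (inj₁ j))
    peel (inj₂ (inj₂ t))        = inj₂ (inj₂ (inj₂ t))

    unpeel : (⊤ ⊎ ⊤) ⊎ SpiderLabel s → SpiderLabel (suc s)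
    unpeel (inj₁ (inj₁ _))        = inj₁ zero
    unpeel (inj₁ (inj₂ _))        = inj₂ (inj₁ zero)
    unpeel (inj₂ (inj₁ j))        = inj₁ (suc j)
    unpeel (inj₂ (inj₂ (inj₁ j))) = inj₂ (inj₁ (suc j))
    unpeel (inj₂ (inj₂ (inj₂ t))) = inj₂ (inj₂ t)

    unpeel∘peel : ∀ l → unpeel (peel l) ≡ l
    unpeel∘peel (inj₁ zero)           = refl
    unpeel∘peel (inj₂ (inj₁ zero))    = refl
    unpeel∘peel (inj₁ (suc j))        = refl
    unpeel∘peel (inj₂ (inj₁ (suc j))) = refl
    unpeel∘peel (inj₂ (inj₂ t))       = refl

    peel-injective : Injective _≡_ _≡_ peel
    peel-injective {l} {l′} e = trans (sym (unpeel∘peel l)) (trans (cong unpeel e) (unpeel∘peel l′))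

    newLeg : ⊤ ⊎ ⊤ → Vertex G
    newLeg = [ const a , const b ]

    labelling : (⊤ ⊎ ⊤) ⊎ SpiderLabel s → Vertex G
    labelling = [ newLeg , vertexOf S ]

    labelling-injective : Injective _≡_ _≡_ labelling
    labelling-injective = [,]-injective
      ([,]-injective (λ _ → refl) (λ _ → refl) λ _ _ → Edge⇒≢ G (proj₁ a→b→r))
      (distinct S)
      λ { (inj₁ _) l e → a∉S (l , sym e) ; (inj₂ _) l e → b∉S (l , sym e) }

    xs′ ys′ : Fin (suc s) → Vertex G
    xs′ = a Vector.∷ xs S
    ys′ = b Vector.∷ ys S

    spiderMap≡labelling∘peel : ∀ l → spiderMap {G} xs′ ys′ r l ≡ labelling (peel l)
    spiderMap≡labelling∘peel (inj₁ zero)           = refl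
    spiderMap≡labelling∘peel (inj₂ (inj₁ zero))    = refl
    spiderMap≡labelling∘peel (inj₁ (suc j))        = refl
    spiderMap≡labelling∘peel (inj₂ (inj₁ (suc j))) = refl
    spiderMap≡labelling∘peel (inj₂ (inj₂ t))       = refl

  addLeg : Spider G r (suc s)
  addLeg = record
    { xs       = xs′
    ; ys       = ys′
    ; paths    = λ { zero → a→b→r ; (suc j) → paths S j }
    ; distinct = λ {l} {l′} e → peel-injective (labelling-injective
        (trans (sym (spiderMap≡labelling∘peel l)) (trans e (spiderMap≡labelling∘peel l′))))
    }

  InSpider-addLeg : ∀ {v} → InSpider addLeg v → v ≢ a → v ≢ b → InSpider S v
  InSpider-addLeg (inj₁ zero           , refl) v≢a v≢b = contradiction refl v≢a
  InSpider-addLeg (inj₂ (inj₁ zero)    , refl) v≢a v≢b = contradiction refl v≢b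
  InSpider-addLeg (inj₁ (suc j)        , e)    v≢a v≢b = inj₁ j , e
  InSpider-addLeg (inj₂ (inj₁ (suc j)) , e)    v≢a v≢b = inj₂ (inj₁ j) , e
  InSpider-addLeg (inj₂ (inj₂ t)       , e)    v≢a v≢b = inj₂ (inj₂ t) , e

Extension : ∀ {G : Digraph} {r : Vertex G} {s : ℕ} → Spider G r s → List (Vertex G) → Vertex G → Set
Extension {G} {r} {s} S Q x =
  Σ[ S′ ∈ Spider G r (suc s) ] (∀ {v} → v ∈ₗ Q → v ≢ x → ¬ InSpider S v → ¬ InSpider S′ v)

module _ {G : Digraph} {r : Vertex G} {s : ℕ} (S : Spider G r s) (Q : List (Vertex G))
         {x y : Vertex G} (x∉S : ¬ InSpider S x) (y∉forbidden : y ∉ₗ legs S ++ Q) where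

  private
    y∉S : y ≢ r → ¬ InSpider S y
    y∉S = ∉legs⇒∉Spider S (λ y∈legs → y∉forbidden (∈-++⁺ˡ y∈legs))

    Q∌y : ∀ {v} → v ∈ₗ Q → v ≢ y
    Q∌y v∈Q refl = y∉forbidden (∈-++⁺ʳ (legs S) v∈Q)

  extendThrough : Path2 G x y r ⊎ Path2 G y x r → Extension S Q x
  extendThrough (inj₁ x→y→r) =
    addLeg S x→y→r x∉S y∉S′ ,
    λ v∈Q v≢x v∉S v∈S′ → v∉S (InSpider-addLeg S x→y→r x∉S y∉S′ v∈S′ v≢x (Q∌y v∈Q))
    where y∉S′ = y∉S (Edge⇒≢ G (proj₁ (proj₂ x→y→r)))
  extendThrough (inj₂ y→x→r) =
    addLeg S y→x→r y∉S′ x∉S ,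
    λ v∈Q v≢x v∉S v∈S′ → v∉S (InSpider-addLeg S y→x→r y∉S′ x∉S v∈S′ (Q∌y v∈Q) v≢x)
    where y∉S′ = y∉S (proj₂ (proj₂ y→x→r))

extend : ∀ {G : Digraph} {r : Vertex G} {s : ℕ} (S : Spider G r s) (Q : List (Vertex G)) {x : Vertex G}
  → IsExtender G (suc (length Q + 2 * s)) x r → ¬ InSpider S x → Extension S Q x
extend {G} {r} {s} S Q {x} (_ , bound) x∉S with pigeonhole (O G x r) (legs S ++ Q) fits
  where
  fits : length (legs S ++ Q) < ∣ O G x r ∣
  fits = ≤-trans (s≤s (≤-reflexive (trans (length-++ (legs S))
           (trans (cong (_+ length Q) (length-legs S)) (+-comm (2 * s) (length Q)))))) bound
... | y , y∈O , y∉forbidden = extendThrough S Q x∉S y∉forbidden (∈O⇒Path2 G y∈O)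

lemma2p1 : (f s : ℕ) (G : Digraph) (r : Vertex G)
    → (F : Fin f → Vertex G)
    → Injective _≡_ _≡_ F
    → (∀ k → IsExtender G (f + 2 * s + toℕ k) (F k) r)
    → (S : Spider G r s)
    → (∀ k → ¬ InSpider S (F k))
    → Spider G r (f + s)
lemma2p1 zero    s G r F F-inj ext S F∉S = S
lemma2p1 (suc f) s G r F F-inj ext S F∉S =
  subst (Spider G r) (+-suc f s)
    (lemma2p1 f (suc s) G r (λ k → F (suc k)) (λ e → suc-injective (F-inj e)) ext′ S′ F∉S′)
  where
  Q : List (Vertex G)
  Q = List.tabulate (λ k → F (suc k))

  grown : Extension S Q (F zero)
  grown = extend S Q (subst (λ i → IsExtender G i (F zero) r) bound (ext zero)) (F∉S zero)
    where
    bound : suc f + 2 * s + 0 ≡ suc (length Q + 2 * s)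
    bound = cong suc (trans (+-identityʳ (f + 2 * s))
                            (cong (_+ 2 * s) (sym (length-tabulate (λ k → F (suc k))))))

  S′ : Spider G r (suc s)
  S′ = proj₁ grown

  F∉S′ : ∀ k → ¬ InSpider S′ (F (suc k))
  F∉S′ k = proj₂ grown (∈-tabulate⁺ k) (λ e → 0≢1+n (sym (F-inj e))) (F∉S (suc k))

  ext′ : ∀ k → IsExtender G (f + 2 * suc s + toℕ k) (F (suc k)) r
  ext′ k = subst (λ i → IsExtender G i (F (suc k)) r) (shift f s (toℕ k)) (ext (suc k))
    where
    shift : ∀ f s k → suc f + 2 * s + suc k ≡ f + 2 * suc s + k
    shift = solve-∀
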